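{- Let $\Sigma$ be a finite alphabet, and let $p$ and $q$ be distinct words on $\Sigma$ of equal length. Suppose that the set of proper borders of $p$ is equal to the set of proper borders of $q$. Then for every $n \in \mathbb{N}$, the map $\phi_L$ (defined below) is a bijection from $A_n(p)$ to $A_n(q)$.
   Context: $\mathbb{N}$ denotes the non-negative integers. For a word $p$ on $\Sigma$, $A_n(p)$ is the set of words of length $n$ on $\Sigma$ that avoid $p$, i.e. that do not contain $p$ as a contiguous factor. A non-empty word $x$ is a border of $p$ if $x$ is both a prefix and a suffix of $p$; it is a proper border if in addition $x \neq p$. The single scan function $L$ acts on a word by replacing the leftmost (contiguous) occurrence of $q$ with $p$; if the word contains no occurrence of $q$, $L$ acts as the identity. For $w \in A_n(p)$, $\phi_L(w) = L^{i}(w)$, where $L^i$ denotes $i$-fold iteration and $i$ is the least non-negative integer such that $L^{i}(w)$ contains no occurrence of $q$ (such an $i$ always exists and $\phi_L(w)\in A_n(q)$). -}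

module Defs where

open import Data.Nat using (ℕ; zero; suc; _<_)
open import Data.Fin using (Fin)
open import Data.Fin.Properties using () renaming (_≟_ to _≟ᶠ_)
open import Data.List using (List; []; _∷_; _++_; length; drop)
open import Data.Bool using (Bool; true; false; _∧_)
open import Data.Product using (Σ; ∃; _×_; _,_)
open import Relation.Nullary using (¬_; yes; no)
open import Relation.Binary.PropositionalEquality using (_≡_)
open import Function using (_⇔_)

Word : ℕ → Set
Word k = List (Fin k)

module _ {k : ℕ} where

  IsPrefix : Word k → Word k → Set
  IsPrefix x w = ∃ λ s → w ≡ x ++ s

  IsSuffix : Word k → Word k → Set
  IsSuffix x w = ∃ λ s → w ≡ s ++ x

  ProperBorder : Word k → Word k → Set
  ProperBorder p x = ¬ (x ≡ []) × IsPrefix x p × IsSuffix x p × ¬ (x ≡ p)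

  Occurs : Word k → Word k → Set
  Occurs p w = ∃ λ u → ∃ λ v → w ≡ u ++ p ++ v

  Avoids : Word k → Word k → Set
  Avoids p w = ¬ Occurs p w

  InA : ℕ → Word k → Word k → Set
  InA n p w = length w ≡ n × Avoids p w

  isPrefix : Word k → Word k → Bool
  isPrefix [] w = true
  isPrefix (x ∷ xs) [] = false
  isPrefix (x ∷ xs) (y ∷ ys) with x ≟ᶠ y
  ... | yes _ = isPrefix xs ys
  ... | no  _ = false

  L : (p q : Word k) → Word k → Word k
  L p q w with isPrefix q w
  L p q w        | true  = p ++ drop (length q) w
  L p q []       | false = []
  L p q (x ∷ xs) | false = x ∷ L p q xs

  iter : (Word k → Word k) → ℕ → Word k → Word k
  iter f zero w = w
  iter f (suc i) w = f (iter f i w)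

  -- Graph of φ_L: PhiL p q w v  iff  v = L^i(w) where i is the least
  -- non-negative integer such that L^i(w) contains no occurrence of q.
  PhiL : (p q : Word k) → Word k → Word k → Set
  PhiL p q w v =
    ∃ λ i → iter (L p q) i w ≡ v
          × Avoids q (iter (L p q) i w)
          × (∀ j → j < i → Occurs q (iter (L p q) j w))

-- Replacing an occurrence of q by p is a terminating rewriting system: at the first
-- position where p and q differ, the letter of q is replaced by that of p, so every
-- step decreases the lexicographic order that puts the letter of p first.  Two
-- overlapping occurrences of q overlap in a proper border of q, which is also a
-- proper border of p; this makes every critical pair joinable, so by Newman's lemma
-- the system is confluent and φ_L computes the unique normal form.  The same holds
-- for rewriting p into q, and reversing rewrite sequences shows that the two normal
-- form maps are mutually inverse between A_n(p) and A_n(q).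
module Submission where

open import Defs
open import Level using (0ℓ)
open import Data.Nat using (ℕ; zero; suc; _+_; _<_; s≤s)
open import Data.Nat.Properties using (suc-injective; m<n⇒m<1+n; n<1+n)
open import Data.Fin.Properties using () renaming (_≟_ to _≟ᶠ_)
open import Data.List using (List; []; _∷_; _++_; length; drop)
open import Data.List.Properties
  using ( ++-assoc; ++-identityʳ; ++-identityˡ-unique; ++-cancelˡ; ++-conicalˡ; ++-conicalʳ
        ; ∷-injective; length-++)
open import Data.Bool using (true; false)
open import Data.Product using (Σ; Σ-syntax; ∃; ∃₂; _×_; _,_; proj₁; proj₂)
open import Data.Sum using (_⊎_; inj₁; inj₂; [_,_])
open import Data.Empty using (⊥-elim)
open import Function using (_⇔_; Equivalence; flip; _∘_)
open import Induction.WellFounded using (WellFounded; Acc; acc; module Subrelation)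
open import Relation.Binary.Core using (Rel)
open import Relation.Binary.Definitions using (DecidableEquality)
open import Relation.Binary.PropositionalEquality
  using (_≡_; _≢_; refl; sym; trans; cong; subst; subst₂; module ≡-Reasoning)
open import Relation.Binary.Construct.Closure.ReflexiveTransitive
  using (Star; ε; _◅_; _◅◅_; gmap; fold; return; reverse)
open import Relation.Binary.Construct.Closure.Transitive
  using (Plus; _∼⁺⟨_⟩_; TransClosure)
  renaming ( [_] to [_]⁺; wellFounded to TransClosure-wellFounded
           ; transitive to TransClosure-transitive)
open import Relation.Binary.Rewriting
  using (StronglyNormalizing; WeaklyConfluent; Confluent; IsNormalForm; sn&wcr⇒cr)
open import Relation.Nullary using (¬_; Dec; yes; no; _because_)
open import Relation.Nullary.Reflects using (Reflects; ofʸ; ofⁿ)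
open import Relation.Nullary.Decidable using (map′; _⊎-dec_)

Joinable : ∀ {A : Set} → Rel A 0ℓ → Rel A 0ℓ
Joinable _⟶_ y z = ∃ λ d → Star _⟶_ y d × Star _⟶_ z d

module _ {A : Set} {_⟶_ : Rel A 0ℓ} where

  joinable-sym : ∀ {y z} → Joinable _⟶_ y z → Joinable _⟶_ z y
  joinable-sym (d , y↠d , z↠d) = d , z↠d , y↠d

  plus-stronglyNormalizing : StronglyNormalizing _⟶_ → StronglyNormalizing (Plus _⟶_)
  plus-stronglyNormalizing sn =
    Subrelation.wellFounded reverse⁺ (TransClosure-wellFounded (flip _⟶_) sn)
    where
    reverse⁺ : ∀ {x y} → Plus _⟶_ y x → TransClosure (flip _⟶_) x y
    reverse⁺ [ r ]⁺ = [ r ]⁺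
    reverse⁺ (_ ∼⁺⟨ r ⟩ s) = TransClosure-transitive (flip _⟶_) (reverse⁺ s) (reverse⁺ r)

  normalForm-unique : Confluent _⟶_ → ∀ {x a b} → Star _⟶_ x a → Star _⟶_ x b →
                      IsNormalForm _⟶_ a → IsNormalForm _⟶_ b → a ≡ b
  normalForm-unique confluent x↠a x↠b a-normal b-normal with confluent x↠a x↠b
  ... | _ , ε , ε = refl
  ... | _ , r ◅ _ , _ = ⊥-elim (a-normal (_ , r))
  ... | _ , ε , r ◅ _ = ⊥-elim (b-normal (_ , r))

module _ {A : Set} where

  ++-equidivisible : ∀ (as bs cs ds : List A) → as ++ bs ≡ cs ++ ds →
    (∃ λ m → cs ≡ as ++ m × bs ≡ m ++ ds) ⊎ (∃ λ m → as ≡ cs ++ m × ds ≡ m ++ bs)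
  ++-equidivisible []       bs cs       ds e = inj₁ (cs , refl , e)
  ++-equidivisible (a ∷ as) bs []       ds e = inj₂ (a ∷ as , refl , sym e)
  ++-equidivisible (a ∷ as) bs (c ∷ cs) ds e with ∷-injective e
  ... | refl , e′ with ++-equidivisible as bs cs ds e′
  ...   | inj₁ (m , refl , bs≡m++ds) = inj₁ (m , refl , bs≡m++ds)
  ...   | inj₂ (m , refl , ds≡m++bs) = inj₂ (m , refl , ds≡m++bs)

  ++-identityˡ-unique-infix : ∀ (xs ys zs : List A) → xs ≡ ys ++ xs ++ zs → ys ≡ []
  ++-identityˡ-unique-infix []       ys       zs e = ++-conicalˡ ys zs (sym e)
  ++-identityˡ-unique-infix (x ∷ xs) []       zs e = refl
  ++-identityˡ-unique-infix (x ∷ xs) (y ∷ ys) zs e with ∷-injective e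
  ... | refl , e′ with ++-conicalʳ ys (x ∷ [])
         (++-identityˡ-unique-infix xs (ys ++ x ∷ []) zs (trans e′ (sym (++-assoc ys (x ∷ []) _))))
  ... | ()

  ++-assoc-≡ : ∀ {xs} (ys zs ws : List A) → xs ≡ ys ++ zs → xs ++ ws ≡ ys ++ zs ++ ws
  ++-assoc-≡ ys zs ws refl = ++-assoc ys zs ws

  drop-length-++ : ∀ (xs ys : List A) → drop (length xs) (xs ++ ys) ≡ ys
  drop-length-++ []       ys = refl
  drop-length-++ (x ∷ xs) ys = drop-length-++ xs ys

  _⟶[_↦_]_ : List A → List A → List A → List A → Set
  x ⟶[ q ↦ p ] y = ∃₂ λ a b → x ≡ a ++ q ++ b × y ≡ a ++ p ++ b

  _⟶*[_↦_]_ : List A → List A → List A → List A → Set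
  x ⟶*[ q ↦ p ] y = Star _⟶[ q ↦ p ]_ x y

  module _ {p q : List A} where

    ⟶-++ˡ : ∀ c {x y} → x ⟶[ q ↦ p ] y → (c ++ x) ⟶[ q ↦ p ] (c ++ y)
    ⟶-++ˡ c (a , b , refl , refl) = c ++ a , b , sym (++-assoc c a _) , sym (++-assoc c a _)

    joinable-++ˡ : ∀ c {y z} → Joinable _⟶[ q ↦ p ]_ y z →
                   Joinable _⟶[ q ↦ p ]_ (c ++ y) (c ++ z)
    joinable-++ˡ c (d , y↠d , z↠d) =
      c ++ d , gmap (c ++_) (⟶-++ˡ c) y↠d , gmap (c ++_) (⟶-++ˡ c) z↠d

    ⟶-flip : ∀ {x y} → x ⟶[ q ↦ p ] y → y ⟶[ p ↦ q ] x
    ⟶-flip (a , b , x≡aqb , y≡apb) = a , b , y≡apb , x≡aqb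

    ⟶-length : length p ≡ length q → ∀ {x y} → x ⟶[ q ↦ p ] y → length y ≡ length x
    ⟶-length |p|≡|q| (a , b , refl , refl) = begin
      length (a ++ p ++ b)             ≡⟨ length-++ a ⟩
      length a + length (p ++ b)       ≡⟨ cong (length a +_) (length-++ p) ⟩
      length a + (length p + length b) ≡⟨ cong (λ n → length a + (n + length b)) |p|≡|q| ⟩
      length a + (length q + length b) ≡⟨ cong (length a +_) (length-++ q) ⟨
      length a + length (q ++ b)       ≡⟨ length-++ a ⟨
      length (a ++ q ++ b)             ∎
      where open ≡-Reasoning

    ⟶*-length : length p ≡ length q → ∀ {x y} → x ⟶*[ q ↦ p ] y → length y ≡ length x
    ⟶*-length |p|≡|q| =
      fold (λ x y → length y ≡ length x) (λ r e → trans e (⟶-length |p|≡|q| r)) refl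

module LexOrder {A : Set} (c₁ c₂ : A) where

  infix 4 _≺_
  data _≺_ : Rel (List A) 0ℓ where
    here  : ∀ {xs ys} → length xs ≡ length ys → c₁ ∷ xs ≺ c₂ ∷ ys
    there : ∀ {x xs ys} → xs ≺ ys → x ∷ xs ≺ x ∷ ys

  ≺-length : ∀ {xs ys} → xs ≺ ys → length xs ≡ length ys
  ≺-length (here |xs|≡|ys|) = cong suc |xs|≡|ys|
  ≺-length (there xs≺ys)   = cong suc (≺-length xs≺ys)

  ≺-++ˡ : ∀ zs {xs ys} → xs ≺ ys → zs ++ xs ≺ zs ++ ys
  ≺-++ˡ []       xs≺ys = xs≺ys
  ≺-++ˡ (z ∷ zs) xs≺ys = there (≺-++ˡ zs xs≺ys)

  ≺-++ʳ : ∀ zs {xs ys} → xs ≺ ys → xs ++ zs ≺ ys ++ zs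
  ≺-++ʳ zs {_ ∷ xs} {_ ∷ ys} (here |xs|≡|ys|) =
    here (trans (length-++ xs) (trans (cong (_+ length zs) |xs|≡|ys|) (sym (length-++ ys))))
  ≺-++ʳ zs (there xs≺ys) = there (≺-++ʳ zs xs≺ys)

  ⟶-decreasing : ∀ {p q} → p ≺ q → ∀ {x y} → x ⟶[ q ↦ p ] y → y ≺ x
  ⟶-decreasing p≺q (a , b , refl , refl) = ≺-++ˡ a (≺-++ʳ b p≺q)

  module _ (c₁≢c₂ : c₁ ≢ c₂) where

    -- The hypothesis on x is vacuous unless x ≡ c₂; it supplies the words that
    -- are smaller at the head.
    mutual
      ∷-acc : ∀ {x xs} → Acc _≺_ xs →
              (x ≡ c₂ → ∀ {zs} → length zs ≡ length xs → Acc _≺_ (c₁ ∷ zs)) → Acc _≺_ (x ∷ xs)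
      ∷-acc xs-acc smaller-head = acc (∷-acc-below xs-acc smaller-head)

      ∷-acc-below : ∀ {x xs} → Acc _≺_ xs →
                    (x ≡ c₂ → ∀ {zs} → length zs ≡ length xs → Acc _≺_ (c₁ ∷ zs)) →
                    ∀ {v} → v ≺ x ∷ xs → Acc _≺_ v
      ∷-acc-below _         smaller-head (here |zs|≡|xs|) = smaller-head refl |zs|≡|xs|
      ∷-acc-below (acc rec) smaller-head (there zs≺xs)    =
        ∷-acc (rec zs≺xs) (λ x≡c₂ |ws|≡|zs| → smaller-head x≡c₂ (trans |ws|≡|zs| (≺-length zs≺xs)))

    c₁∷-acc : ∀ {zs} → Acc _≺_ zs → Acc _≺_ (c₁ ∷ zs)
    c₁∷-acc zs-acc = ∷-acc zs-acc (λ c₁≡c₂ → ⊥-elim (c₁≢c₂ c₁≡c₂))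

    acc-of-length : ∀ n {xs} → length xs ≡ n → Acc _≺_ xs
    acc-of-length _       {[]}     _     = acc λ ()
    acc-of-length (suc n) {x ∷ xs} |x∷xs|≡1+n =
      ∷-acc (acc-of-length n |xs|≡n)
            (λ _ |zs|≡|xs| → c₁∷-acc (acc-of-length n (trans |zs|≡|xs| |xs|≡n)))
      where
      |xs|≡n : length xs ≡ n
      |xs|≡n = suc-injective |x∷xs|≡1+n

    ≺-wellFounded : WellFounded _≺_
    ≺-wellFounded xs = acc-of-length (length xs) refl

module _ {A : Set} where
  open LexOrder using (here; there)

  first-difference : DecidableEquality A → ∀ (xs ys : List A) → xs ≢ ys → length xs ≡ length ys →
                     ∃₂ λ c₁ c₂ → c₁ ≢ c₂ × LexOrder._≺_ c₁ c₂ xs ys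
  first-difference _≟_ []       []       []≢[] _ = ⊥-elim ([]≢[] refl)
  first-difference _≟_ (x ∷ xs) (y ∷ ys) x∷xs≢y∷ys |x∷xs|≡|y∷ys| with x ≟ y
  ... | no x≢y   = x , y , x≢y , here (suc-injective |x∷xs|≡|y∷ys|)
  ... | yes refl
    with first-difference _≟_ xs ys (x∷xs≢y∷ys ∘ cong (x ∷_)) (suc-injective |x∷xs|≡|y∷ys|)
  ...   | c₁ , c₂ , c₁≢c₂ , xs≺ys = c₁ , c₂ , c₁≢c₂ , there xs≺ys

  ⟶-stronglyNormalizing : DecidableEquality A → ∀ {p q : List A} → p ≢ q → length p ≡ length q →
                          StronglyNormalizing _⟶[ q ↦ p ]_
  ⟶-stronglyNormalizing _≟_ p≢q |p|≡|q| with first-difference _≟_ _ _ p≢q |p|≡|q|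
  ... | c₁ , c₂ , c₁≢c₂ , p≺q =
    Subrelation.wellFounded (⟶-decreasing p≺q) (≺-wellFounded c₁≢c₂)
    where open LexOrder c₁ c₂

module _ {k : ℕ} where

  isPrefix-reflects : ∀ (x w : Word k) → Reflects (IsPrefix x w) (isPrefix x w)
  isPrefix-reflects []      w       = ofʸ (w , refl)
  isPrefix-reflects (c ∷ x) []      = ofⁿ λ ()
  isPrefix-reflects (c ∷ x) (d ∷ w) with c ≟ᶠ d
  ... | no c≢d = ofⁿ λ (_ , d∷w≡c∷x++s) → c≢d (sym (proj₁ (∷-injective d∷w≡c∷x++s)))
  ... | yes refl with isPrefix x w | isPrefix-reflects x w
  ...   | true  | ofʸ (s , w≡x++s) = ofʸ (s , cong (c ∷_) w≡x++s)
  ...   | false | ofⁿ ¬prefix      =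
    ofⁿ λ (s , c∷w≡c∷x++s) → ¬prefix (s , proj₂ (∷-injective c∷w≡c∷x++s))

  isPrefix? : ∀ (x w : Word k) → Dec (IsPrefix x w)
  isPrefix? x w = isPrefix x w because isPrefix-reflects x w

  prefix⇒occurs : ∀ {q w : Word k} → IsPrefix q w → Occurs q w
  prefix⇒occurs (s , w≡q++s) = [] , s , w≡q++s

  occurs-∷⁺ : ∀ {q w : Word k} c → Occurs q w → Occurs q (c ∷ w)
  occurs-∷⁺ c (a , b , w≡aqb) = c ∷ a , b , cong (c ∷_) w≡aqb

  occurs-[]⁻ : ∀ {q : Word k} → Occurs q [] → IsPrefix q []
  occurs-[]⁻ ([] , b , []≡q++b) = b , []≡q++b

  occurs-∷⁻ : ∀ {q w : Word k} {c} → Occurs q (c ∷ w) → IsPrefix q (c ∷ w) ⊎ Occurs q w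
  occurs-∷⁻ ([]    , b , c∷w≡q++b)   = inj₁ (b , c∷w≡q++b)
  occurs-∷⁻ (_ ∷ a , b , c∷w≡c∷aqb) = inj₂ (a , b , proj₂ (∷-injective c∷w≡c∷aqb))

  occurs? : ∀ (q w : Word k) → Dec (Occurs q w)
  occurs? q []      = map′ prefix⇒occurs occurs-[]⁻ (isPrefix? q [])
  occurs? q (c ∷ w) =
    map′ [ prefix⇒occurs , occurs-∷⁺ c ] occurs-∷⁻ (isPrefix? q (c ∷ w) ⊎-dec occurs? q w)

  L-step : ∀ (p q w : Word k) → Occurs q w → w ⟶[ q ↦ p ] L p q w
  L-step p q w q∈w with isPrefix q w | isPrefix-reflects q w
  ... | true | ofʸ (s , refl) = [] , s , refl , cong (p ++_) (drop-length-++ q s)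
  L-step p q []      q∈w | false | ofⁿ ¬prefix = ⊥-elim (¬prefix (occurs-[]⁻ q∈w))
  L-step p q (c ∷ w) q∈w | false | ofⁿ ¬prefix =
    [ ⊥-elim ∘ ¬prefix , ⟶-++ˡ (c ∷ []) ∘ L-step p q w ] (occurs-∷⁻ q∈w)

  iter-shift : ∀ (f : Word k → Word k) i w → iter f i (f w) ≡ iter f (suc i) w
  iter-shift f zero    w = refl
  iter-shift f (suc i) w = cong f (iter-shift f i w)

  module _ {p q : Word k} where

    PhiL-stop : ∀ {w} → Avoids q w → PhiL p q w w
    PhiL-stop q∉w = 0 , refl , q∉w , λ _ ()

    PhiL-step : ∀ {w v} → Occurs q w → PhiL p q (L p q w) v → PhiL p q w v
    PhiL-step {w} q∈w (i , Lw↦v , q∉v , q∈before) =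
      suc i , trans (sym (iter-shift (L p q) i w)) Lw↦v ,
      subst (Avoids q) (iter-shift (L p q) i w) q∉v , q∈before′
      where
      q∈before′ : ∀ j → j < suc i → Occurs q (iter (L p q) j w)
      q∈before′ zero    _         = q∈w
      q∈before′ (suc j) (s≤s j<i) = subst (Occurs q) (iter-shift (L p q) j w) (q∈before j j<i)

    PhiL-total : StronglyNormalizing _⟶[ q ↦ p ]_ → ∀ w → ∃ (PhiL p q w)
    PhiL-total sn w = go w (sn w)
      where
      go : ∀ w → Acc (flip _⟶[ q ↦ p ]_) w → ∃ (PhiL p q w)
      go w (acc rec) with occurs? q w
      ... | no  q∉w = w , PhiL-stop q∉w
      ... | yes q∈w with go (L p q w) (rec (L-step p q w q∈w))
      ...   | v , φ = v , PhiL-step q∈w φ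

    iter-L-⟶* : ∀ {w} i → (∀ j → j < i → Occurs q (iter (L p q) j w)) →
                w ⟶*[ q ↦ p ] iter (L p q) i w
    iter-L-⟶* zero    _        = ε
    iter-L-⟶* (suc i) q∈before =
      iter-L-⟶* i (λ j j<i → q∈before j (m<n⇒m<1+n j<i))
        ◅◅ return (L-step p q _ (q∈before i (n<1+n i)))

    PhiL-⟶* : ∀ {w v} → PhiL p q w v → w ⟶*[ q ↦ p ] v
    PhiL-⟶* (i , refl , _ , q∈before) = iter-L-⟶* i q∈before

    PhiL-avoids : ∀ {w v} → PhiL p q w v → Avoids q v
    PhiL-avoids (_ , refl , q∉v , _) = q∉v

    PhiL-InA : length p ≡ length q → ∀ {n w v} → length w ≡ n → PhiL p q w v → InA n q v
    PhiL-InA |p|≡|q| |w|≡n φ = trans (⟶*-length |p|≡|q| (PhiL-⟶* φ)) |w|≡n , PhiL-avoids φ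

    avoids⇒normal : ∀ {w} → Avoids q w → IsNormalForm _⟶[ q ↦ p ]_ w
    avoids⇒normal q∉w (_ , a , b , w≡aqb , _) = q∉w (a , b , w≡aqb)

  module _ {p q : Word k} where

    PhiL-injective : Confluent _⟶[ p ↦ q ]_ → ∀ {w w′ v} → Avoids p w → Avoids p w′ →
                     PhiL p q w v → PhiL p q w′ v → w ≡ w′
    PhiL-injective confluent p∉w p∉w′ φ φ′ =
      normalForm-unique confluent (reverse ⟶-flip (PhiL-⟶* φ)) (reverse ⟶-flip (PhiL-⟶* φ′))
        (avoids⇒normal p∉w) (avoids⇒normal p∉w′)

    PhiL-reverse-identity : Confluent _⟶[ q ↦ p ]_ → ∀ {v w v′} → Avoids q v →
                            PhiL q p v w → PhiL p q w v′ → v′ ≡ v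
    PhiL-reverse-identity confluent q∉v ψ φ =
      normalForm-unique confluent (PhiL-⟶* φ) (reverse ⟶-flip (PhiL-⟶* ψ))
        (avoids⇒normal (PhiL-avoids φ)) (avoids⇒normal q∉v)

  module _ {p q : Word k} (borders : ∀ x → ProperBorder q x → ProperBorder p x) where

    private
      _⟶_ : Rel (Word k) 0ℓ
      _⟶_ = _⟶[ q ↦ p ]_

    disjoint-redexes-joinable : ∀ t b → Joinable _⟶_ (p ++ t ++ q ++ b) (q ++ t ++ p ++ b)
    disjoint-redexes-joinable t b =
      p ++ t ++ p ++ b ,
      return (p ++ t , b , sym (++-assoc p t (q ++ b)) , sym (++-assoc p t (p ++ b))) ,
      return ([] , t ++ p ++ b , refl , refl)

    -- The overlap s is a proper border of q, hence of p; this is the only place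
    -- where the hypothesis on borders is used.
    overlapping-redexes-joinable : ∀ {t s u} b → q ≡ t ++ s → q ≡ s ++ u → ProperBorder q s →
                                   Joinable _⟶_ (p ++ u ++ b) (t ++ p ++ b)
    overlapping-redexes-joinable {t} {s} {u} b q≡ts q≡su s-border
      with borders s s-border
    ... | _ , (u′ , p≡su′) , (t′ , p≡t′s) , _ =
      p ++ u′ ++ b , return (t′ , b , pub≡t′qb , pu′b≡t′pb) , return ([] , u′ ++ b , tpb≡qu′b , refl)
      where
      pub≡t′qb : p ++ u ++ b ≡ t′ ++ q ++ b
      pub≡t′qb = trans (++-assoc-≡ t′ s (u ++ b) p≡t′s) (cong (t′ ++_) (sym (++-assoc-≡ s u b q≡su)))

      pu′b≡t′pb : p ++ u′ ++ b ≡ t′ ++ p ++ b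
      pu′b≡t′pb =
        trans (++-assoc-≡ t′ s (u′ ++ b) p≡t′s) (cong (t′ ++_) (sym (++-assoc-≡ s u′ b p≡su′)))

      tpb≡qu′b : t ++ p ++ b ≡ q ++ u′ ++ b
      tpb≡qu′b = trans (cong (t ++_) (++-assoc-≡ s u′ b p≡su′)) (sym (++-assoc-≡ t s (u′ ++ b) q≡ts))

    -- The second occurrence of q starts |t| > 0 letters after the first: either at or
    -- after its end (disjoint redexes), or inside it, overlapping it in a non-empty s.
    shifted-redexes-joinable : ∀ t b₁ b₂ → t ≢ [] → q ++ b₁ ≡ t ++ q ++ b₂ →
                               Joinable _⟶_ (p ++ b₁) (t ++ p ++ b₂)
    shifted-redexes-joinable t b₁ b₂ t≢[] qb₁≡tqb₂
      with ++-equidivisible q b₁ t (q ++ b₂) qb₁≡tqb₂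
    ... | inj₁ (t′ , refl , refl) =
      subst (Joinable _⟶_ _) (sym (++-assoc q t′ (p ++ b₂))) (disjoint-redexes-joinable t′ b₂)
    ... | inj₂ (s , q≡ts , qb₂≡sb₁) with ++-equidivisible s b₁ q b₂ (sym qb₂≡sb₁)
    ...   | inj₂ (e , s≡qe , refl) =
      ⊥-elim (t≢[] (++-identityˡ-unique-infix q t e (trans q≡ts (cong (t ++_) s≡qe))))
    ...   | inj₁ (u , q≡su , refl) with s
    ...     | [] = subst₂ (λ u′ t′ → Joinable _⟶_ (p ++ u′ ++ b₂) (t′ ++ p ++ b₂))
                          q≡su (trans q≡ts (++-identityʳ t)) (disjoint-redexes-joinable [] b₂)
    ...     | s@(_ ∷ _) =
      overlapping-redexes-joinable b₂ q≡ts q≡su ((λ ()) , (u , q≡su) , (t , q≡ts) , s≢q)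
      where
      s≢q : s ≢ q
      s≢q s≡q = t≢[] (++-identityˡ-unique t (trans q≡ts (cong (t ++_) s≡q)))

    redexes-joinable : ∀ t b₁ b₂ → q ++ b₁ ≡ t ++ q ++ b₂ → Joinable _⟶_ (p ++ b₁) (t ++ p ++ b₂)
    redexes-joinable []      b₁ b₂ qb₁≡qb₂ rewrite ++-cancelˡ q b₁ b₂ qb₁≡qb₂ = _ , ε , ε
    redexes-joinable (c ∷ t) b₁ b₂ = shifted-redexes-joinable (c ∷ t) b₁ b₂ λ ()

    ⟶-locallyConfluent : WeaklyConfluent _⟶_
    ⟶-locallyConfluent (a₁ , b₁ , refl , refl) (a₂ , b₂ , a₁qb₁≡a₂qb₂ , refl)
      with ++-equidivisible a₁ (q ++ b₁) a₂ (q ++ b₂) a₁qb₁≡a₂qb₂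
    ... | inj₁ (t , refl , qb₁≡tqb₂) =
      subst (Joinable _⟶_ _) (sym (++-assoc a₁ t (p ++ b₂)))
            (joinable-++ˡ a₁ (redexes-joinable t b₁ b₂ qb₁≡tqb₂))
    ... | inj₂ (t , refl , qb₂≡tqb₁) =
      joinable-sym (subst (Joinable _⟶_ _) (sym (++-assoc a₂ t (p ++ b₁)))
                          (joinable-++ˡ a₂ (redexes-joinable t b₂ b₁ qb₂≡tqb₁)))

    ⟶-confluent : p ≢ q → length p ≡ length q → Confluent _⟶_
    ⟶-confluent p≢q |p|≡|q| =
      sn&wcr⇒cr (plus-stronglyNormalizing (⟶-stronglyNormalizing _≟ᶠ_ p≢q |p|≡|q|))
                ⟶-locallyConfluent

theorem1 : (k : ℕ) (p q : Word k) → ¬ (p ≡ q) → length p ≡ length q →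
    (∀ (x : Word k) → ProperBorder p x ⇔ ProperBorder q x) →
    (n : ℕ) →
    Σ[ f ∈ (Σ (Word k) (InA n p) → Σ (Word k) (InA n q)) ]
      (∀ w → PhiL p q (proj₁ w) (proj₁ (f w)))
      × (∀ w w′ → proj₁ (f w) ≡ proj₁ (f w′) → proj₁ w ≡ proj₁ w′)
      × (∀ (v : Σ (Word k) (InA n q)) → ∃ λ (w : Σ (Word k) (InA n p)) → proj₁ (f w) ≡ proj₁ v)
theorem1 k p q p≢q |p|≡|q| same-borders n = f , proj₂ ∘ φ ∘ proj₁ , f-injective , f-surjective
  where
  φ : ∀ w → ∃ (PhiL p q w)
  φ = PhiL-total (⟶-stronglyNormalizing _≟ᶠ_ p≢q |p|≡|q|)

  ψ : ∀ v → ∃ (PhiL q p v)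
  ψ = PhiL-total (⟶-stronglyNormalizing _≟ᶠ_ (p≢q ∘ sym) (sym |p|≡|q|))

  f : Σ (Word k) (InA n p) → Σ (Word k) (InA n q)
  f (w , |w|≡n , _) = proj₁ (φ w) , PhiL-InA |p|≡|q| |w|≡n (proj₂ (φ w))

  f-injective : ∀ w w′ → proj₁ (f w) ≡ proj₁ (f w′) → proj₁ w ≡ proj₁ w′
  f-injective (w , _ , p∉w) (w′ , _ , p∉w′) φw≡φw′ =
    PhiL-injective (⟶-confluent (Equivalence.to ∘ same-borders) (p≢q ∘ sym) (sym |p|≡|q|))
      p∉w p∉w′ (proj₂ (φ w)) (subst (PhiL p q w′) (sym φw≡φw′) (proj₂ (φ w′)))

  f-surjective : ∀ v → ∃ λ w → proj₁ (f w) ≡ proj₁ v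
  f-surjective (v , |v|≡n , q∉v) with ψ v
  ... | w , ψv = (w , PhiL-InA (sym |p|≡|q|) |v|≡n ψv) ,
    PhiL-reverse-identity (⟶-confluent (Equivalence.from ∘ same-borders) p≢q |p|≡|q|)
      q∉v ψv (proj₂ (φ w))
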